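{- Let $G$ be a thin spider with spider partition $(S,K,R)$, and let $e$ be a non-edge of $G$ joining a vertex $s\in S$ and a vertex of $R$. Let $\mu$ be the number of fill edges in an optimal solution of the ($P_4$-sparse,$+1$)-MinEdgeAddition Problem for the (disconnected) induced subgraph $G[\{s\}\cup R]$ and the non-edge $e$. Then the ($P_4$-sparse,$+1$)-MinEdgeAddition Problem for $G$ and $e$ admits an optimal solution with exactly $|K|-1+\mu$ fill edges (including $e$).
   Context: All graphs are finite, simple, undirected. A graph is $P_4$-sparse if no five vertices induce more than one $P_4$. A thin spider is a graph whose vertex set has a partition $(S,K,R)$ with $S$ independent, $K$ a clique, $|S|=|K|\ge2$, every vertex of $R$ adjacent to all of $K$ and none of $S$, and a bijection $f:S\to K$ with $N(s)\cap K=\{f(s)\}$ for every $s\in S$. ($P_4$-sparse,$+1$)-MinEdgeAddition Problem: for a $P_4$-sparse graph $G$ and a non-edge $e$, a solution is a $P_4$-sparse graph $H$ with $V(H)=V(G)$ and $E(G)\cup\{e\}\subseteq E(H)$; fill edges are the edges of $E(H)\setminus E(G)$ (including $e$); an optimal solution minimizes their number. -}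

module Defs where

open import Data.Nat using (ℕ; zero; suc; _+_; _∸_; _≤_; _<_)
open import Data.Bool using (Bool; true; false; _∧_; not; if_then_else_)
open import Data.Fin using (Fin; toℕ; _<?_)
open import Data.Fin.Properties using ()
open import Data.Product using (Σ; _×_; _,_; ∃)
open import Data.Sum using (_⊎_)
open import Relation.Nullary using (¬_; does)
open import Relation.Binary.PropositionalEquality using (_≡_)
open import Function.Definitions using (Injective)

record Graph (n : ℕ) : Set where
  field
    adj    : Fin n → Fin n → Bool
    sym    : ∀ u v → adj u v ≡ adj v u
    irrefl : ∀ v → adj v v ≡ false
open Graph public

Edge : ∀ {n} → Graph n → Fin n → Fin n → Set
Edge G u v = adj G u v ≡ true

NonEdge : ∀ {n} → Graph n → Fin n → Fin n → Set
NonEdge G u v = adj G u v ≡ false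

IsP4 : ∀ {n} → Graph n → Fin n → Fin n → Fin n → Fin n → Set
IsP4 G a b c d =
  Edge G a b × Edge G b c × Edge G c d ×
  NonEdge G a c × NonEdge G b d × NonEdge G a d

Among : ∀ {m} → Fin m → Fin m → Fin m → Fin m → Fin m → Set
Among x a b c d = x ≡ a ⊎ x ≡ b ⊎ x ≡ c ⊎ x ≡ d

-- P4-sparse: no five vertices induce more than one P4.
P4Sparse : ∀ {n} → Graph n → Set
P4Sparse {n} G =
  (v : Fin 5 → Fin n) → Injective _≡_ _≡_ v →
  (a b c d a′ b′ c′ d′ : Fin 5) →
  IsP4 G (v a) (v b) (v c) (v d) →
  IsP4 G (v a′) (v b′) (v c′) (v d′) →
  Among a′ a b c d × Among b′ a b c d × Among c′ a b c d × Among d′ a b c d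

sumFin : ∀ {n} → (Fin n → ℕ) → ℕ
sumFin {zero}  f = 0
sumFin {suc n} f = f Fin.zero + sumFin (λ i → f (Fin.suc i))

count : ∀ {n} → (Fin n → Bool) → ℕ
count p = sumFin (λ i → if p i then 1 else 0)

data Part : Set where
  inS inK inR : Part

isK : Part → Bool
isK inK = true
isK _   = false

record ThinSpider {n : ℕ} (G : Graph n) : Set where
  field
    part : Fin n → Part
    f    : Fin n → Fin n       -- the bijection S → K (values off S irrelevant)
    f-K       : ∀ s → part s ≡ inS → part (f s) ≡ inK
    f-inj     : ∀ s t → part s ≡ inS → part t ≡ inS → f s ≡ f t → s ≡ t
    f-surj    : ∀ k → part k ≡ inK → Σ (Fin n) λ s → part s ≡ inS × f s ≡ k
    S-≥2      : Σ (Fin n) λ s → Σ (Fin n) λ t →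
                  part s ≡ inS × part t ≡ inS × ¬ (s ≡ t)
    S-indep   : ∀ s t → part s ≡ inS → part t ≡ inS → NonEdge G s t
    K-clique  : ∀ k l → part k ≡ inK → part l ≡ inK → ¬ (k ≡ l) → Edge G k l
    R-K       : ∀ r k → part r ≡ inR → part k ≡ inK → Edge G r k
    R-S       : ∀ r s → part r ≡ inR → part s ≡ inS → NonEdge G r s
    S-K       : ∀ s k → part s ≡ inS → part k ≡ inK →
                  (Edge G s k → k ≡ f s) × (k ≡ f s → Edge G s k)
open ThinSpider public

cardK : ∀ {n} {G : Graph n} → ThinSpider G → ℕ
cardK T = count (λ x → isK (part T x))

induce : ∀ {m n} → Graph n → (Fin m → Fin n) → Graph m
induce G ι = record
  { adj    = λ i j → adj G (ι i) (ι j)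
  ; sym    = λ i j → sym G (ι i) (ι j)
  ; irrefl = λ i → irrefl G (ι i)
  }

IsSolution : ∀ {n} → Graph n → Fin n → Fin n → Graph n → Set
IsSolution {n} G u v H =
  P4Sparse H × Edge H u v × (∀ x y → Edge G x y → Edge H x y)

fill : ∀ {n} → Graph n → Graph n → ℕ
fill G H = sumFin λ x → count λ y →
  does (x <? y) ∧ adj H x y ∧ not (adj G x y)

IsOptimal : ∀ {n} → Graph n → Fin n → Fin n → Graph n → Set
IsOptimal {n} G u v H =
  IsSolution G u v H × (∀ H′ → IsSolution G u v H′ → fill G H ≤ fill G H′)

{-# OPTIONS --safe #-}
-- Let M = {s} ∪ R, the image of ι. Replace G[M] by H′ and attach every vertex of M to the
-- rest of G as r is attached (to all of K, to nothing in S ∖ {s}); the fill edges are those of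
-- H′ together with s k for k ∈ K ∖ {f s}. The result is P4-sparse: M is a module, so an
-- induced P4 meets M in 0, 1 or 4 vertices; 1 is impossible because r lies on no induced P4
-- with its other vertices in (S ∖ {s}) ∪ K, and P4s inside or outside M inherit sparseness
-- from H′ and G. Conversely, for k ∈ K ∖ {f s} with partner t = f⁻¹ k, every solution adds
-- one of s k, s t, r t, (f s) t, since otherwise s r k t and s (f s) k t are two P4s on five
-- vertices. These pairs are distinct for distinct k and none lies inside M, where any solution
-- induces a solution for G[M].
module Submission where

open import Defs hiding (sym)

open import Data.Bool using (Bool; true; false; _∧_; not; if_then_else_)
import Data.Bool as Bool
open import Data.Bool.Properties using (∧-comm; ∧-zeroʳ; ∧-inverseʳ; ∧-identityʳ; ¬-not)
open import Data.Empty using (⊥; ⊥-elim)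
open import Data.Fin using (Fin; _≟_; _<?_)
open import Data.Fin.Patterns using (0F; 1F; 2F; 3F; 4F)
open import Data.Fin.Properties using (<-cmp; <⇒≢; pigeonhole; any?; all?; ¬∀⟶∃¬)
open import Data.Nat using (ℕ; _+_; _*_; _∸_; _≤_; z≤n)
open import Data.Nat.Properties
  using ( +-0-commutativeMonoid; +-comm; +-identityʳ; *-distribˡ-+; *-cancelˡ-≡; *-cancelˡ-≤
        ; ≤-refl; ≤-reflexive; ≤-trans; +-mono-≤; +-monoʳ-≤; *-monoʳ-≤; n<1+n; n≢0⇒n>0; n≤0⇒n≡0
        ; m+n≡0⇒m≡0; m+n≡0⇒n≡0; m+n∸n≡m; module ≤-Reasoning )
open import Data.Product using (Σ; ∃; _×_; _,_; proj₁; proj₂)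
open import Data.Sum using (_⊎_; inj₁; inj₂)
open import Data.Vec using ([]; _∷_; lookup)
open import Data.Vec.Relation.Unary.All using (All; []; _∷_)
open import Data.Vec.Relation.Unary.AllPairs using ([]; _∷_)
open import Data.Vec.Relation.Unary.Unique.Propositional using (Unique)
open import Data.Vec.Relation.Unary.Unique.Propositional.Properties using (lookup-injective)
open import Function.Base using (_∘_)
open import Function.Definitions using (Injective)
open import Level using (0ℓ)
open import Relation.Binary.Definitions using (tri<; tri≈; tri>)
open import Relation.Binary.PropositionalEquality
open import Relation.Nullary using (¬_; Dec; yes; no; does)
open import Relation.Nullary.Decidable using (dec-true; dec-false; _×-dec_; _⊎-dec_; ¬?)
open import Relation.Unary using (Pred; Decidable)
open import Relation.Unary.Properties using (U?)

open import Algebra.Properties.CommutativeMonoid.Sum +-0-commutativeMonoid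
  using (sum; sum-cong-≗; sum-replicate-zero; ∑-distrib-+; ∑-comm)

infixl 7 _when_

_when_ : ℕ → Bool → ℕ
x when b = if b then x else 0

sumFin≡sum : ∀ {n} (f : Fin n → ℕ) → sumFin f ≡ sum f
sumFin≡sum {ℕ.zero}  f = refl
sumFin≡sum {ℕ.suc n} f = cong (f Fin.zero +_) (sumFin≡sum (f ∘ Fin.suc))

sum-mono-≤ : ∀ {n} {f g : Fin n → ℕ} → (∀ i → f i ≤ g i) → sum f ≤ sum g
sum-mono-≤ {ℕ.zero}  f≤g = z≤n
sum-mono-≤ {ℕ.suc n} f≤g = +-mono-≤ (f≤g Fin.zero) (sum-mono-≤ (f≤g ∘ Fin.suc))

sum-zero : ∀ {n} {f : Fin n → ℕ} → (∀ i → f i ≡ 0) → sum f ≡ 0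
sum-zero {n} f≗0 = trans (sum-cong-≗ f≗0) (sum-replicate-zero n)

sum-single : ∀ {n} (a : Fin n) (h : Fin n → ℕ) → sum (λ y → h y when does (a ≟ y)) ≡ h a
sum-single {ℕ.suc n} Fin.zero h = trans (cong (h Fin.zero +_) (sum-zero {n} (λ _ → refl))) (+-identityʳ _)
sum-single {ℕ.suc n} (Fin.suc a) h = sum-single a (h ∘ Fin.suc)

point≤sum : ∀ {n} (h : Fin n → ℕ) (a : Fin n) → h a ≤ sum h
point≤sum h a = ≤-trans (≤-reflexive (sym (sum-single a h)))
  (sum-mono-≤ λ y → when-≤ (h y) (does (a ≟ y)))
  where
  when-≤ : ∀ x b → x when b ≤ x
  when-≤ x true  = ≤-refl
  when-≤ x false = z≤n

sum-when : ∀ {n} (b : Bool) (f : Fin n → ℕ) → sum (λ y → f y when b) ≡ sum f when b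
sum-when true  f = refl
sum-when {n} false f = sum-zero {n} (λ _ → refl)

when-∧ : ∀ x a b → x when b when a ≡ x when (a ∧ b)
when-∧ x true  b = refl
when-∧ x false b = refl

when-split : ∀ x b → x ≡ x when b + x when not b
when-split x true  = sym (+-identityʳ x)
when-split x false = refl

sum-when-unique : ∀ {n} {B : Pred (Fin n) 0ℓ} (B? : Decidable B) →
  (∀ {k l} → B k → B l → k ≡ l) →
  ∀ c → sum (λ k → c when does (B? k)) ≡ c when does (any? B?)
sum-when-unique B? unique c with any? B?
... | yes (k , Bk) = trans (sum-cong-≗ (cong (c when_) ∘ B?≡k≟)) (sum-single k (λ _ → c))
  where
  B?≡k≟ : ∀ l → does (B? l) ≡ does (k ≟ l)
  B?≡k≟ l with B? l
  ... | yes Bl = sym (dec-true (k ≟ l) (unique Bk Bl))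
  ... | no ¬Bl = sym (dec-false (k ≟ l) λ { refl → ¬Bl Bk })
... | no ∄B = sum-zero λ l → cong (c when_) (dec-false (B? l) λ Bl → ∄B (l , Bl))

sum-fibres : ∀ {m n} (g : Fin m → Fin n) {P : Pred (Fin m) 0ℓ} (P? : Decidable P) (h : Fin n → ℕ) →
  sum (λ k → h (g k) when does (P? k)) ≡
  sum (λ y → sum (λ k → h y when does (P? k ×-dec g k ≟ y)))
sum-fibres g P? h = begin
  sum (λ k → h (g k) when does (P? k))
    ≡⟨ sum-cong-≗ (λ k → cong (_when does (P? k)) (sym (sum-single (g k) h))) ⟩
  sum (λ k → sum (λ y → h y when does (g k ≟ y)) when does (P? k))
    ≡⟨ sum-cong-≗ (λ k → sym (sum-when (does (P? k)) (λ y → h y when does (g k ≟ y)))) ⟩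
  sum (λ k → sum (λ y → h y when does (g k ≟ y) when does (P? k)))
    ≡⟨ sum-cong-≗ (λ k → sum-cong-≗ (λ y → when-∧ (h y) (does (P? k)) _)) ⟩
  sum (λ k → sum (λ y → h y when does (P? k ×-dec g k ≟ y)))
    ≡⟨ ∑-comm (λ k y → h y when does (P? k ×-dec g k ≟ y)) ⟩
  sum (λ y → sum (λ k → h y when does (P? k ×-dec g k ≟ y))) ∎
  where open ≡-Reasoning

sum-reindex-≤ : ∀ {m n} (g : Fin m → Fin n) {P : Pred (Fin m) 0ℓ} {Q : Pred (Fin n) 0ℓ}
  (P? : Decidable P) (Q? : Decidable Q) →
  (∀ {k} → P k → Q (g k)) → (∀ {k l} → P k → P l → g k ≡ g l → k ≡ l) →
  (h : Fin n → ℕ) → sum (λ k → h (g k) when does (P? k)) ≤ sum (λ y → h y when does (Q? y))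
sum-reindex-≤ g P? Q? P⇒Q g-inj h = ≤-trans (≤-reflexive (sum-fibres g P? h)) (sum-mono-≤ fibre≤)
  where
  fibre≤ : ∀ y → sum (λ k → h y when does (P? k ×-dec g k ≟ y)) ≤ h y when does (Q? y)
  fibre≤ y rewrite sum-when-unique (λ k → P? k ×-dec g k ≟ y)
                     (λ (Pk , gk≡y) (Pl , gl≡y) → g-inj Pk Pl (trans gk≡y (sym gl≡y))) (h y)
    with any? (λ k → P? k ×-dec g k ≟ y)
  ... | no _ = z≤n
  ... | yes (k , Pk , refl) rewrite dec-true (Q? (g k)) (P⇒Q Pk) = ≤-refl

Image : ∀ {m n} → (Fin m → Fin n) → Pred (Fin n) 0ℓ
Image ι y = ∃ λ i → ι i ≡ y

image? : ∀ {m n} (ι : Fin m → Fin n) → Decidable (Image ι)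
image? ι y = any? λ i → ι i ≟ y

sum-image : ∀ {m n} (ι : Fin m → Fin n) → Injective _≡_ _≡_ ι → (h : Fin n → ℕ) →
  sum (h ∘ ι) ≡ sum (λ y → h y when does (image? ι y))
sum-image ι ι-inj h = trans (sum-fibres ι U? h)
  (sum-cong-≗ λ y → sum-when-unique (λ k → ι k ≟ y)
                      (λ ιk≡y ιl≡y → ι-inj (trans ιk≡y (sym ιl≡y))) (h y))

-- Counting fill edges

newEdge : ∀ {n} → Graph n → Graph n → Fin n → Fin n → ℕ
newEdge G H x y = 1 when (adj H x y ∧ not (adj G x y))

newEdge-sym : ∀ {n} (G H : Graph n) x y → newEdge G H x y ≡ newEdge G H y x
newEdge-sym G H x y rewrite Graph.sym G x y | Graph.sym H x y = refl

newEdge≡0⇒NonEdge : ∀ {n} {G H : Graph n} {x y} → NonEdge G x y → newEdge G H x y ≡ 0 → NonEdge H x y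
newEdge≡0⇒NonEdge {H = H} {x} {y} xy∉G δ≡0 with adj H x y
... | false = refl
... | true rewrite xy∉G with () ← δ≡0

newEdge-split-< : ∀ {n} (G H : Graph n) x y →
  newEdge G H x y ≡ newEdge G H x y when does (x <? y) + newEdge G H y x when does (y <? x)
newEdge-split-< G H x y with <-cmp x y
... | tri< x<y _ y≮x rewrite dec-true (x <? y) x<y | dec-false (y <? x) y≮x = sym (+-identityʳ _)
... | tri> x≮y _ y<x rewrite dec-false (x <? y) x≮y | dec-true (y <? x) y<x = newEdge-sym G H x y
... | tri≈ x≮y refl _ rewrite dec-false (x <? x) x≮y | Graph.irrefl H x = refl

fill≡sum : ∀ {n} (G H : Graph n) → fill G H ≡ sum λ x → sum λ y → newEdge G H x y when does (x <? y)
fill≡sum {n} G H = trans (sumFin≡sum (λ x → count (fresh x)))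
  (sum-cong-≗ λ x → trans (sumFin≡sum (λ y → 1 when fresh x y))
  (sum-cong-≗ λ y → sym (when-∧ 1 (does (x <? y)) (adj H x y ∧ not (adj G x y)))))
  where
  fresh : Fin n → Fin n → Bool
  fresh x y = does (x <? y) ∧ adj H x y ∧ not (adj G x y)

fill-cong : ∀ {n} (G : Graph n) {H H′ : Graph n} → (∀ x y → adj H x y ≡ adj H′ x y) →
  fill G H ≡ fill G H′
fill-cong G {H} {H′} H≈H′ = trans (fill≡sum G H) (trans
  (sum-cong-≗ λ x → sum-cong-≗ λ y →
     cong (λ b → 1 when (b ∧ not (adj G x y)) when does (x <? y)) (H≈H′ x y))
  (sym (fill≡sum G H′)))

-- Ordered pairs count every fill edge twice but avoid the orientation x < y used by `fill`.
orderedFill : ∀ {n} → Graph n → Graph n → ℕ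
orderedFill G H = sum λ x → sum λ y → newEdge G H x y

orderedFill≡2*fill : ∀ {n} (G H : Graph n) → orderedFill G H ≡ 2 * fill G H
orderedFill≡2*fill {n} G H = begin
  orderedFill G H
    ≡⟨ sum-cong-≗ (λ x → trans (sum-cong-≗ (newEdge-split-< G H x))
                               (∑-distrib-+ (below x) (λ y → below y x))) ⟩
  sum (λ x → sum (λ y → below x y) + sum (λ y → below y x))
    ≡⟨ ∑-distrib-+ (λ x → sum (below x)) (λ x → sum (λ y → below y x)) ⟩
  sum (λ x → sum (λ y → below x y)) + sum (λ x → sum (λ y → below y x))
    ≡⟨ cong (sum (λ x → sum (below x)) +_) (sym (∑-comm below)) ⟩
  sum (λ x → sum (λ y → below x y)) + sum (λ x → sum (λ y → below x y))
    ≡⟨ cong₂ _+_ (sym (fill≡sum G H)) (sym (fill≡sum G H)) ⟩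
  fill G H + fill G H
    ≡⟨ cong (fill G H +_) (sym (+-identityʳ _)) ⟩
  2 * fill G H ∎
  where
  open ≡-Reasoning
  below : Fin n → Fin n → ℕ
  below x y = newEdge G H x y when does (x <? y)

crossNewEdge : ∀ {m n} → (Fin m → Fin n) → Graph n → Graph n → Fin n → Fin n → ℕ
crossNewEdge ι G H x y = newEdge G H x y when not (does (image? ι x ×-dec image? ι y))

crossNewEdge-sym : ∀ {m n} (ι : Fin m → Fin n) (G H : Graph n) x y →
  crossNewEdge ι G H x y ≡ crossNewEdge ι G H y x
crossNewEdge-sym ι G H x y = cong₂ _when_ (newEdge-sym G H x y)
  (cong not (∧-comm (does (image? ι x)) (does (image? ι y))))

crossFill : ∀ {m n} → (Fin m → Fin n) → Graph n → Graph n → ℕ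
crossFill ι G H = sum λ x → sum λ y → crossNewEdge ι G H x y

orderedFill-induce : ∀ {m n} (ι : Fin m → Fin n) → Injective _≡_ _≡_ ι → (G H : Graph n) →
  orderedFill (induce G ι) (induce H ι) ≡
  sum (λ x → sum λ y → newEdge G H x y when does (image? ι x ×-dec image? ι y))
orderedFill-induce ι ι-inj G H = begin
  sum (λ i → sum (λ j → newEdge G H (ι i) (ι j)))
    ≡⟨ sum-cong-≗ (λ i → sum-image ι ι-inj (newEdge G H (ι i))) ⟩
  sum (λ i → sum (λ y → newEdge G H (ι i) y when does (image? ι y)))
    ≡⟨ sum-image ι ι-inj (λ x → sum (λ y → newEdge G H x y when does (image? ι y))) ⟩
  sum (λ x → sum (λ y → newEdge G H x y when does (image? ι y)) when does (image? ι x))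
    ≡⟨ sum-cong-≗ (λ x → sym (sum-when (does (image? ι x)) (λ y → newEdge G H x y when does (image? ι y)))) ⟩
  sum (λ x → sum (λ y → newEdge G H x y when does (image? ι y) when does (image? ι x)))
    ≡⟨ sum-cong-≗ (λ x → sum-cong-≗ (λ y →
         when-∧ (newEdge G H x y) (does (image? ι x)) (does (image? ι y)))) ⟩
  sum (λ x → sum λ y → newEdge G H x y when does (image? ι x ×-dec image? ι y)) ∎
  where open ≡-Reasoning

orderedFill-split : ∀ {m n} (ι : Fin m → Fin n) → Injective _≡_ _≡_ ι → (G H : Graph n) →
  orderedFill G H ≡ orderedFill (induce G ι) (induce H ι) + crossFill ι G H
orderedFill-split {n = n} ι ι-inj G H = begin
  orderedFill G H
    ≡⟨ sum-cong-≗ (λ x → trans (sum-cong-≗ (λ y → when-split (newEdge G H x y) (inside x y)))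
                                (∑-distrib-+ (λ y → newEdge G H x y when inside x y) _)) ⟩
  sum (λ x → sum (λ y → newEdge G H x y when inside x y) + sum (λ y → newEdge G H x y when not (inside x y)))
    ≡⟨ ∑-distrib-+ (λ x → sum (λ y → newEdge G H x y when inside x y)) _ ⟩
  sum (λ x → sum (λ y → newEdge G H x y when inside x y)) + crossFill ι G H
    ≡⟨ cong (_+ crossFill ι G H) (sym (orderedFill-induce ι ι-inj G H)) ⟩
  orderedFill (induce G ι) (induce H ι) + crossFill ι G H ∎
  where
  open ≡-Reasoning
  inside : Fin n → Fin n → Bool
  inside x y = does (image? ι x ×-dec image? ι y)

2*fill-split : ∀ {m n} (ι : Fin m → Fin n) → Injective _≡_ _≡_ ι → (G H : Graph n) →
  2 * fill G H ≡ 2 * fill (induce G ι) (induce H ι) + crossFill ι G H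
2*fill-split ι ι-inj G H = begin
  2 * fill G H
    ≡⟨ sym (orderedFill≡2*fill G H) ⟩
  orderedFill G H
    ≡⟨ orderedFill-split ι ι-inj G H ⟩
  orderedFill (induce G ι) (induce H ι) + crossFill ι G H
    ≡⟨ cong (_+ crossFill ι G H) (orderedFill≡2*fill (induce G ι) (induce H ι)) ⟩
  2 * fill (induce G ι) (induce H ι) + crossFill ι G H ∎
  where open ≡-Reasoning

outDegree : ∀ {n} {Y : Pred (Fin n) 0ℓ} → Decidable Y → Graph n → Graph n → Fin n → ℕ
outDegree Y? G H y = sum λ x → newEdge G H y x when not (does (Y? x))

boundaryFill : ∀ {n} {Y : Pred (Fin n) 0ℓ} → Decidable Y → Graph n → Graph n → ℕ
boundaryFill Y? G H = sum λ y → outDegree Y? G H y when does (Y? y)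

boundaryFill-≤-crossFill : ∀ {m n} (ι : Fin m → Fin n) {Y : Pred (Fin n) 0ℓ} (Y? : Decidable Y) →
  (∀ {y} → Y y → ¬ Image ι y) → (G H : Graph n) → 2 * boundaryFill Y? G H ≤ crossFill ι G H
boundaryFill-≤-crossFill {n = n} ι Y? Y∩ι=∅ G H = begin
  2 * boundaryFill Y? G H
    ≡⟨ cong (λ b → b + (b + 0)) (sum-cong-≗ λ y →
         trans (sym (sum-when (does (Y? y)) λ x → newEdge G H y x when not (does (Y? x))))
               (sum-cong-≗ λ x → when-∧ (newEdge G H y x) (does (Y? y)) (not (does (Y? x))))) ⟩
  leaving + (leaving + 0)
    ≡⟨ cong (λ b → leaving + b) (trans (+-identityʳ leaving) (∑-comm out)) ⟩
  leaving + sum (λ x → sum (λ y → out y x))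
    ≡⟨ sym (∑-distrib-+ (λ x → sum (out x)) (λ x → sum (λ y → out y x))) ⟩
  sum (λ x → sum (out x) + sum (λ y → out y x))
    ≡⟨ sum-cong-≗ (λ x → sym (∑-distrib-+ (out x) (λ y → out y x))) ⟩
  sum (λ x → sum (λ y → out x y + out y x))
    ≤⟨ sum-mono-≤ (λ x → sum-mono-≤ (out≤cross x)) ⟩
  crossFill ι G H ∎
  where
  open ≤-Reasoning
  out : Fin n → Fin n → ℕ
  out y x = newEdge G H y x when does (Y? y ×-dec ¬? (Y? x))
  leaving : ℕ
  leaving = sum λ y → sum (out y)
  out≤cross : ∀ x y → out x y + out y x ≤ crossNewEdge ι G H x y
  out≤cross x y with Y? x | Y? y
  ... | yes Yx | no _ rewrite dec-false (image? ι x) (Y∩ι=∅ Yx) = ≤-reflexive (+-identityʳ _)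
  ... | no _ | yes Yy rewrite dec-false (image? ι y) (Y∩ι=∅ Yy) | ∧-zeroʳ (does (image? ι x)) =
    ≤-reflexive (newEdge-sym G H y x)
  ... | yes _ | yes _ = z≤n
  ... | no _ | no _ = z≤n

-- Induced P4s

adj-flip : ∀ {n} (X : Graph n) {x y β} → adj X x y ≡ β → adj X y x ≡ β
adj-flip X {x} {y} = trans (Graph.sym X y x)

Edge⇒≢ : ∀ {n} (X : Graph n) {x y} → Edge X x y → x ≢ y
Edge⇒≢ X {x} xy refl with () ← trans (sym xy) (Graph.irrefl X x)

Edge∧NonEdge⇒≢ : ∀ {n} (X : Graph n) {x y z} → Edge X x y → NonEdge X x z → y ≢ z
Edge∧NonEdge⇒≢ X xy xz refl with () ← trans (sym xy) xz

IsP4-reverse : ∀ {n} (X : Graph n) {a b c d} → IsP4 X a b c d → IsP4 X d c b a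
IsP4-reverse X (ab , bc , cd , ac , bd , ad) =
  adj-flip X cd , adj-flip X bc , adj-flip X ab , adj-flip X bd , adj-flip X ac , adj-flip X ad

IsP4-unique : ∀ {n k} (X : Graph n) (v : Fin k → Fin n) {a b c d} →
  IsP4 X (v a) (v b) (v c) (v d) → Unique (a ∷ b ∷ c ∷ d ∷ [])
IsP4-unique X v (ab , bc , cd , ac , _ , ad) =
  (≢ (Edge⇒≢ X ab) ∷ ≢ (≢-sym (Edge∧NonEdge⇒≢ X (adj-flip X cd) (adj-flip X ad)))
     ∷ ≢ (≢-sym (Edge∧NonEdge⇒≢ X cd (adj-flip X ac))) ∷ [])
  ∷ (≢ (Edge⇒≢ X bc) ∷ ≢ (Edge∧NonEdge⇒≢ X ab ad) ∷ [])
  ∷ (≢ (Edge⇒≢ X cd) ∷ [])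
  ∷ [] ∷ []
  where
  ≢ : ∀ {i j} → v i ≢ v j → i ≢ j
  ≢ vi≢vj refl = vi≢vj refl

IsP4-transport : ∀ {n k} {X : Graph n} {Y : Graph k} (v : Fin 5 → Fin n) (w : Fin 5 → Fin k) →
  (∀ i j → adj X (v i) (v j) ≡ adj Y (w i) (w j)) →
  ∀ {a b c d} → IsP4 X (v a) (v b) (v c) (v d) → IsP4 Y (w a) (w b) (w c) (w d)
IsP4-transport v w v≈w {a} {b} {c} {d} (ab , bc , cd , ac , bd , ad) =
  trans (sym (v≈w a b)) ab , trans (sym (v≈w b c)) bc , trans (sym (v≈w c d)) cd ,
  trans (sym (v≈w a c)) ac , trans (sym (v≈w b d)) bd , trans (sym (v≈w a d)) ad

no-six-distinct : {a b c d x y : Fin 5} → ¬ Unique (a ∷ b ∷ c ∷ d ∷ x ∷ y ∷ [])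
no-six-distinct {a} {b} {c} {d} {x} {y} distinct
  with i , j , i<j , same ← pigeonhole (n<1+n 5) (lookup (a ∷ b ∷ c ∷ d ∷ x ∷ y ∷ []))
  = <⇒≢ i<j (lookup-injective distinct i j same)

among? : ∀ {n} (x a b c d : Fin n) → Dec (Among x a b c d)
among? x a b c d = x ≟ a ⊎-dec x ≟ b ⊎-dec x ≟ c ⊎-dec x ≟ d

among-except-outsider : {a b c d x y : Fin 5} → Unique (a ∷ b ∷ c ∷ d ∷ []) →
  ¬ Among x a b c d → y ≢ x → Among y a b c d
among-except-outsider {a} {b} {c} {d} {x} {y}
  ((a≢b ∷ a≢c ∷ a≢d ∷ []) ∷ (b≢c ∷ b≢d ∷ []) ∷ (c≢d ∷ []) ∷ [] ∷ []) x∉ y≢x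
  with among? y a b c d
... | yes y∈ = y∈
... | no y∉ = ⊥-elim (no-six-distinct
  ((a≢b ∷ a≢c ∷ a≢d ∷ ≢ x∉ inj₁ ∷ ≢ y∉ inj₁ ∷ [])
  ∷ (b≢c ∷ b≢d ∷ ≢ x∉ (inj₂ ∘ inj₁) ∷ ≢ y∉ (inj₂ ∘ inj₁) ∷ [])
  ∷ (c≢d ∷ ≢ x∉ (inj₂ ∘ inj₂ ∘ inj₁) ∷ ≢ y∉ (inj₂ ∘ inj₂ ∘ inj₁) ∷ [])
  ∷ (≢ x∉ (inj₂ ∘ inj₂ ∘ inj₂) ∷ ≢ y∉ (inj₂ ∘ inj₂ ∘ inj₂) ∷ [])
  ∷ ((λ x≡y → y≢x (sym x≡y)) ∷ [])
  ∷ [] ∷ []))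
  where
  ≢ : ∀ {w z} → ¬ Among w a b c d → (w ≡ z → Among w a b c d) → z ≢ w
  ≢ w∉ among z≡w = w∉ (among (sym z≡w))

among-All : ∀ {k n} (v : Fin k → Fin n) {Q : Fin n → Set} {x a b c d} →
  Among x a b c d → All Q (v a ∷ v b ∷ v c ∷ v d ∷ []) → Q (v x)
among-All v (inj₁ refl)               (Qa ∷ _)              = Qa
among-All v (inj₂ (inj₁ refl))        (_ ∷ Qb ∷ _)          = Qb
among-All v (inj₂ (inj₂ (inj₁ refl))) (_ ∷ _ ∷ Qc ∷ _)      = Qc
among-All v (inj₂ (inj₂ (inj₂ refl))) (_ ∷ _ ∷ _ ∷ Qd ∷ []) = Qd

P4Sparse-induce : ∀ {m n} {X : Graph n} (ι : Fin m → Fin n) → Injective _≡_ _≡_ ι →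
  P4Sparse X → P4Sparse (induce X ι)
P4Sparse-induce ι ι-inj X-sparse v v-inj = X-sparse (ι ∘ v) (v-inj ∘ ι-inj)

IsSolution-induce : ∀ {m n} {G X : Graph n} (ι : Fin m → Fin n) → Injective _≡_ _≡_ ι →
  ∀ {u v u′ v′} → ι u′ ≡ u → ι v′ ≡ v →
  IsSolution G u v X → IsSolution (induce G ι) u′ v′ (induce X ι)
IsSolution-induce {X = X} ι ι-inj refl refl (X-sparse , uv , G⊆X) =
  P4Sparse-induce {X = X} ι ι-inj X-sparse , uv , λ i j → G⊆X (ι i) (ι j)

-- Substituting a graph for a module

module Substitution {m n} (G : Graph n) (ι : Fin m → Fin n) (ι-inj : Injective _≡_ _≡_ ι)
                    (H′ : Graph m) (o : Fin n) where

  substAdj : Fin n → Fin n → Bool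
  substAdj x y with image? ι x | image? ι y
  ... | yes (i , _) | yes (j , _) = adj H′ i j
  ... | yes _       | no _        = adj G o y
  ... | no _        | yes _       = adj G x o
  ... | no _        | no _        = adj G x y

  substAdj-sym : ∀ x y → substAdj x y ≡ substAdj y x
  substAdj-sym x y with image? ι x | image? ι y
  ... | yes (i , _) | yes (j , _) = Graph.sym H′ i j
  ... | yes _       | no _        = Graph.sym G o y
  ... | no _        | yes _       = Graph.sym G x o
  ... | no _        | no _        = Graph.sym G x y

  substAdj-irrefl : ∀ x → substAdj x x ≡ false
  substAdj-irrefl x with image? ι x
  ... | yes (i , _) = Graph.irrefl H′ i
  ... | no _        = Graph.irrefl G x

  Sub : Graph n
  Sub = record { adj = substAdj ; sym = substAdj-sym ; irrefl = substAdj-irrefl }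

  adj-ι-ι : ∀ i j → adj Sub (ι i) (ι j) ≡ adj H′ i j
  adj-ι-ι i j with image? ι (ι i) | image? ι (ι j)
  ... | yes (i′ , ιi′≡ιi) | yes (j′ , ιj′≡ιj) = cong₂ (adj H′) (ι-inj ιi′≡ιi) (ι-inj ιj′≡ιj)
  ... | no ∉ | _     = ⊥-elim (∉ (i , refl))
  ... | yes _ | no ∉ = ⊥-elim (∉ (j , refl))

  adj-in-out : ∀ {x y} → Image ι x → ¬ Image ι y → adj Sub x y ≡ adj G o y
  adj-in-out {x} {y} x∈ y∉ with image? ι x | image? ι y
  ... | yes _ | no _  = refl
  ... | no x∉ | _     = ⊥-elim (x∉ x∈)
  ... | yes _ | yes y∈ = ⊥-elim (y∉ y∈)

  adj-out-out : ∀ {x y} → ¬ Image ι x → ¬ Image ι y → adj Sub x y ≡ adj G x y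
  adj-out-out {x} {y} x∉ y∉ with image? ι x | image? ι y
  ... | no _   | no _   = refl
  ... | yes x∈ | _      = ⊥-elim (x∉ x∈)
  ... | no _   | yes y∈ = ⊥-elim (y∉ y∈)

  adj-out-in : ∀ {x y} → ¬ Image ι x → Image ι y → adj Sub x y ≡ adj G x o
  adj-out-in {x} {y} x∉ y∈ = trans (substAdj-sym x y) (trans (adj-in-out y∈ x∉) (Graph.sym G o x))

  image-is-module : ∀ {x x′ y} → Image ι x → Image ι x′ → ¬ Image ι y →
    Edge Sub x y → NonEdge Sub x′ y → ⊥
  image-is-module x∈ x′∈ y∉ xy x′y
    with () ← trans (sym xy) (trans (adj-in-out x∈ y∉) (trans (sym (adj-in-out x′∈ y∉)) x′y))

  IsP4-replace-end : ∀ {a b c d} → Image ι a → ¬ Image ι b → ¬ Image ι c → ¬ Image ι d →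
    IsP4 Sub a b c d → IsP4 G o b c d
  IsP4-replace-end a∈ b∉ c∉ d∉ (ab , bc , cd , ac , bd , ad) =
    trans (sym (adj-in-out a∈ b∉)) ab , trans (sym (adj-out-out b∉ c∉)) bc ,
    trans (sym (adj-out-out c∉ d∉)) cd , trans (sym (adj-in-out a∈ c∉)) ac ,
    trans (sym (adj-out-out b∉ d∉)) bd , trans (sym (adj-in-out a∈ d∉)) ad

  IsP4-replace-inner : ∀ {a b c d} → ¬ Image ι a → Image ι b → ¬ Image ι c → ¬ Image ι d →
    IsP4 Sub a b c d → IsP4 G a o c d
  IsP4-replace-inner a∉ b∈ c∉ d∉ (ab , bc , cd , ac , bd , ad) =
    trans (sym (adj-out-in a∉ b∈)) ab , trans (sym (adj-in-out b∈ c∉)) bc ,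
    trans (sym (adj-out-out c∉ d∉)) cd , trans (sym (adj-out-out a∉ c∉)) ac ,
    trans (sym (adj-in-out b∈ d∉)) bd , trans (sym (adj-out-out a∉ d∉)) ad

  OffOutsideP4s : Set
  OffOutsideP4s = ∀ {b c d} → ¬ Image ι b → ¬ Image ι c → ¬ Image ι d →
    ¬ IsP4 G o b c d × ¬ IsP4 G b o c d

  P4-inside-or-outside : OffOutsideP4s → ∀ {a b c d} → IsP4 Sub a b c d →
    All (Image ι) (a ∷ b ∷ c ∷ d ∷ []) ⊎ All (¬_ ∘ Image ι) (a ∷ b ∷ c ∷ d ∷ [])
  P4-inside-or-outside off {a} {b} {c} {d} P@(ab , bc , cd , ac , bd , ad) =
    classify (image? ι a) (image? ι b) (image? ι c) (image? ι d)
    where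
    classify : Dec (Image ι a) → Dec (Image ι b) → Dec (Image ι c) → Dec (Image ι d) →
      All (Image ι) (a ∷ b ∷ c ∷ d ∷ []) ⊎ All (¬_ ∘ Image ι) (a ∷ b ∷ c ∷ d ∷ [])
    classify (yes a∈) (yes b∈) (yes c∈) (yes d∈) = inj₁ (a∈ ∷ b∈ ∷ c∈ ∷ d∈ ∷ [])
    classify (no a∉) (no b∉) (no c∉) (no d∉) = inj₂ (a∉ ∷ b∉ ∷ c∉ ∷ d∉ ∷ [])
    classify (yes a∈) (no b∉) (no c∉) (no d∉) =
      ⊥-elim (proj₁ (off b∉ c∉ d∉) (IsP4-replace-end a∈ b∉ c∉ d∉ P))
    classify (no a∉) (yes b∈) (no c∉) (no d∉) =
      ⊥-elim (proj₂ (off a∉ c∉ d∉) (IsP4-replace-inner a∉ b∈ c∉ d∉ P))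
    classify (no a∉) (no b∉) (yes c∈) (no d∉) =
      ⊥-elim (proj₂ (off d∉ b∉ a∉) (IsP4-replace-inner d∉ c∈ b∉ a∉ (IsP4-reverse Sub P)))
    classify (no a∉) (no b∉) (no c∉) (yes d∈) =
      ⊥-elim (proj₁ (off c∉ b∉ a∉) (IsP4-replace-end d∈ c∉ b∉ a∉ (IsP4-reverse Sub P)))
    classify (yes a∈) (yes b∈) (no c∉) _ = ⊥-elim (image-is-module b∈ a∈ c∉ bc ac)
    classify (yes a∈) (no b∉) _ (yes d∈) = ⊥-elim (image-is-module a∈ d∈ b∉ ab (adj-flip Sub bd))
    classify (yes a∈) (no b∉) (yes c∈) (no d∉) = ⊥-elim (image-is-module c∈ a∈ d∉ cd ad)
    classify (no a∉) (yes b∈) (yes c∈) _ =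
      ⊥-elim (image-is-module b∈ c∈ a∉ (adj-flip Sub ab) (adj-flip Sub ac))
    classify (no a∉) (yes b∈) (no c∉) (yes d∈) =
      ⊥-elim (image-is-module b∈ d∈ a∉ (adj-flip Sub ab) (adj-flip Sub ad))
    classify (no a∉) (no b∉) (yes c∈) (yes d∈) =
      ⊥-elim (image-is-module c∈ d∈ b∉ (adj-flip Sub bc) (adj-flip Sub bd))
    classify (yes a∈) (yes b∈) (yes c∈) (no d∉) = ⊥-elim (image-is-module c∈ a∈ d∉ cd ad)

  IsP4-outside : ∀ {a b c d} → All (¬_ ∘ Image ι) (a ∷ b ∷ c ∷ d ∷ []) → IsP4 Sub a b c d → IsP4 G a b c d
  IsP4-outside (a∉ ∷ b∉ ∷ c∉ ∷ d∉ ∷ []) (ab , bc , cd , ac , bd , ad) =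
    trans (sym (adj-out-out a∉ b∉)) ab , trans (sym (adj-out-out b∉ c∉)) bc ,
    trans (sym (adj-out-out c∉ d∉)) cd , trans (sym (adj-out-out a∉ c∉)) ac ,
    trans (sym (adj-out-out b∉ d∉)) bd , trans (sym (adj-out-out a∉ d∉)) ad

  among-inside-P4 : (v : Fin 5 → Fin n) {a b c d x y : Fin 5} → IsP4 Sub (v a) (v b) (v c) (v d) →
    All (Image ι) (v a ∷ v b ∷ v c ∷ v d ∷ []) → ¬ Image ι (v x) → y ≢ x → Among y a b c d
  among-inside-P4 v P P-in x∉ = among-except-outsider (IsP4-unique Sub v P) (λ x∈ → x∉ (among-All v x∈ P-in))

  no-P4s-on-both-sides : (v : Fin 5 → Fin n) {a b c d a′ b′ c′ d′ : Fin 5} →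
    IsP4 Sub (v a) (v b) (v c) (v d) → IsP4 Sub (v a′) (v b′) (v c′) (v d′) →
    All (Image ι) (v a ∷ v b ∷ v c ∷ v d ∷ []) →
    All (¬_ ∘ Image ι) (v a′ ∷ v b′ ∷ v c′ ∷ v d′ ∷ []) → ⊥
  no-P4s-on-both-sides v P (a′b′ , _) P-in (a′∉ ∷ b′∉ ∷ _) =
    b′∉ (among-All v (among-inside-P4 v P P-in a′∉ λ b′≡a′ → Edge⇒≢ Sub a′b′ (cong v (sym b′≡a′))) P-in)

  P4Sparse-Sub : P4Sparse G → P4Sparse H′ → OffOutsideP4s → P4Sparse Sub
  P4Sparse-Sub G-sparse H′-sparse off v v-inj a b c d a′ b′ c′ d′ P Q
    with P4-inside-or-outside off P | P4-inside-or-outside off Q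
  ... | inj₂ P-out | inj₂ Q-out =
    G-sparse v v-inj a b c d a′ b′ c′ d′ (IsP4-outside P-out P) (IsP4-outside Q-out Q)
  ... | inj₁ P-in | inj₂ Q-out = ⊥-elim (no-P4s-on-both-sides v P Q P-in Q-out)
  ... | inj₂ P-out | inj₁ Q-in = ⊥-elim (no-P4s-on-both-sides v Q P Q-in P-out)
  ... | inj₁ P-in | inj₁ (a′∈ ∷ b′∈ ∷ c′∈ ∷ d′∈ ∷ []) with all? (λ i → image? ι (v i))
  ...   | yes all-in = H′-sparse v′ v′-inj a b c d a′ b′ c′ d′ (toH′ P) (toH′ Q)
    where
    v′ : Fin 5 → Fin m
    v′ i = proj₁ (all-in i)
    ιv′≡v : ∀ i → ι (v′ i) ≡ v i
    ιv′≡v i = proj₂ (all-in i)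
    v′-inj : Injective _≡_ _≡_ v′
    v′-inj {i} {j} v′i≡v′j = v-inj (trans (sym (ιv′≡v i)) (trans (cong ι v′i≡v′j) (ιv′≡v j)))
    toH′ : ∀ {a b c d} → IsP4 Sub (v a) (v b) (v c) (v d) → IsP4 H′ (v′ a) (v′ b) (v′ c) (v′ d)
    toH′ = IsP4-transport {X = Sub} {Y = H′} v v′ λ i j →
      subst₂ (λ x y → adj Sub x y ≡ adj H′ (v′ i) (v′ j)) (ιv′≡v i) (ιv′≡v j) (adj-ι-ι (v′ i) (v′ j))
  ...   | no not-all with j , j∉ ← ¬∀⟶∃¬ 5 (λ i → Image ι (v i)) (λ i → image? ι (v i)) not-all =
    among a′∈ , among b′∈ , among c′∈ , among d′∈
    where
    among : ∀ {x} → Image ι (v x) → Among x a b c d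
    among x∈ = among-inside-P4 v P P-in j∉ λ { refl → j∉ x∈ }

module ThinSpiderProperties {n} {G : Graph n} (T : ThinSpider G) where

  R-adj : ∀ {x y} → part T x ≡ inR → part T y ≢ inR → adj G x y ≡ isK (part T y)
  R-adj {x} {y} x∈R y∉R with part T y in y∈
  ... | inS = R-S T x y x∈R y∈
  ... | inK = R-K T x y x∈R y∈
  ... | inR = ⊥-elim (y∉R refl)

  S-adj-K : ∀ {x y} → part T x ≡ inS → part T y ≡ inK → adj G x y ≡ does (y ≟ f T x)
  S-adj-K {x} {y} x∈S y∈K with y ≟ f T x
  ... | yes y≡fx = proj₂ (S-K T x y x∈S y∈K) y≡fx
  ... | no y≢fx = ¬-not λ xy → y≢fx (proj₁ (S-K T x y x∈S y∈K) xy)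

  isK⇒K : ∀ {p} → Bool.T (isK p) → p ≡ inK
  isK⇒K {inK} _ = refl

  part-≢ : ∀ {x y p q} → part T x ≡ p → part T y ≡ q → p ≢ q → x ≢ y
  part-≢ x∈ y∈ p≢q refl = p≢q (trans (sym x∈) y∈)

  S-neighbour : ∀ {x y} → part T x ≡ inS → Edge G x y → y ≡ f T x
  S-neighbour {x} {y} x∈S xy with part T y in y∈
  ... | inK = proj₁ (S-K T x y x∈S y∈) xy
  ... | inS with () ← trans (sym xy) (S-indep T x y x∈S y∈)
  ... | inR with () ← trans (sym xy) (adj-flip G (R-S T y x y∈ x∈S))

  private
    partnerFor : ∀ k p → part T k ≡ p → Fin n
    partnerFor k inK k∈K = proj₁ (f-surj T k k∈K)
    partnerFor k _   _   = k

    partnerFor-spec : ∀ k p (k∈ : part T k ≡ p) → p ≡ inK →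
      part T (partnerFor k p k∈) ≡ inS × f T (partnerFor k p k∈) ≡ k
    partnerFor-spec k inK k∈K _ = proj₂ (f-surj T k k∈K)

  -- f⁻¹ on K; the identity elsewhere.
  partner : Fin n → Fin n
  partner k = partnerFor k (part T k) refl

  partner-spec : ∀ {k} → part T k ≡ inK → part T (partner k) ≡ inS × f T (partner k) ≡ k
  partner-spec {k} = partnerFor-spec k (part T k) refl

-- Expanding an optimal solution for G[{s} ∪ R]

module ThinSpiderExpansion {n} (G : Graph n) (G-sparse : P4Sparse G) (T : ThinSpider G) (s r : Fin n)
  (s∈S : part T s ≡ inS) (r∈R : part T r ≡ inR)
  {m} (ι : Fin m → Fin n) (ι-inj : Injective _≡_ _≡_ ι)
  (image-ι : ∀ x → (x ≡ s ⊎ part T x ≡ inR → Image ι x) × (Image ι x → x ≡ s ⊎ part T x ≡ inR))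
  (s′ r′ : Fin m) (ιs′≡s : ι s′ ≡ s) (ιr′≡r : ι r′ ≡ r)
  (H′ : Graph m) (H′-optimal : IsOptimal (induce G ι) s′ r′ H′) where

  open ThinSpiderProperties T
  open Substitution G ι ι-inj H′ r public

  fs : Fin n
  fs = f T s

  fs∈K : part T fs ≡ inK
  fs∈K = f-K T s s∈S

  s∈ι : Image ι s
  s∈ι = proj₁ (image-ι s) (inj₁ refl)

  r∈ι : Image ι r
  r∈ι = proj₁ (image-ι r) (inj₂ r∈R)

  outside⇒≢s : ∀ {y} → ¬ Image ι y → y ≢ s
  outside⇒≢s y∉ refl = y∉ s∈ι

  outside⇒∉R : ∀ {y} → ¬ Image ι y → part T y ≢ inR
  outside⇒∉R {y} y∉ y∈R = y∉ (proj₁ (image-ι y) (inj₂ y∈R))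

  K⇒outside : ∀ {y} → part T y ≡ inK → ¬ Image ι y
  K⇒outside {y} y∈K y∈ with proj₂ (image-ι y) y∈
  ... | inj₁ refl with () ← trans (sym s∈S) y∈K
  ... | inj₂ y∈R with () ← trans (sym y∈R) y∈K

  S∖s⇒outside : ∀ {y} → part T y ≡ inS → y ≢ s → ¬ Image ι y
  S∖s⇒outside {y} y∈S y≢s y∈ with proj₂ (image-ι y) y∈
  ... | inj₁ y≡s = y≢s y≡s
  ... | inj₂ y∈R with () ← trans (sym y∈S) y∈R

  r-adj-outside : ∀ {y} → ¬ Image ι y → adj G r y ≡ isK (part T y)
  r-adj-outside y∉ = R-adj r∈R (outside⇒∉R y∉)

  outside-neighbour-of-r : ∀ {y} → ¬ Image ι y → Edge G r y → part T y ≡ inK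
  outside-neighbour-of-r y∉ ry = isK⇒K (subst Bool.T (sym (trans (sym (r-adj-outside y∉)) ry)) _)

  outside-non-neighbour-of-r : ∀ {y} → ¬ Image ι y → NonEdge G r y → part T y ≡ inS
  outside-non-neighbour-of-r {y} y∉ ry with part T y in y∈
  ... | inS = refl
  ... | inK with () ← trans (sym ry) (R-K T r y r∈R y∈)
  ... | inR = ⊥-elim (outside⇒∉R y∉ y∈)

  r-off-outside-P4s : OffOutsideP4s
  r-off-outside-P4s {b} {c} {d} b∉ c∉ d∉ = r-not-end , r-not-inner
    where
    r-not-end : ¬ IsP4 G r b c d
    r-not-end (rb , bc , cd , rc , _ , rd) =
      Edge∧NonEdge⇒≢ G rb rd (trans (S-neighbour c∈S (adj-flip G bc)) (sym (S-neighbour c∈S cd)))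
      where
      c∈S : part T c ≡ inS
      c∈S = outside-non-neighbour-of-r c∉ rc
    r-not-inner : ¬ IsP4 G b r c d
    r-not-inner (br , rc , cd , bc , _ , bd) with () ← trans (sym bc)
      (K-clique T b c (outside-neighbour-of-r b∉ (adj-flip G br)) (outside-neighbour-of-r c∉ rc)
                      (≢-sym (Edge∧NonEdge⇒≢ G (adj-flip G cd) (adj-flip G bd))))

  image-edge⇒r-edge : ∀ {x y} → Image ι x → ¬ Image ι y → Edge G x y → Edge G r y
  image-edge⇒r-edge {x} {y} x∈ y∉ xy with proj₂ (image-ι x) x∈
  ... | inj₁ refl = R-K T r y r∈R (subst (λ z → part T z ≡ inK) (sym (S-neighbour s∈S xy)) fs∈K)
  ... | inj₂ x∈R = trans (r-adj-outside y∉) (trans (sym (R-adj x∈R (outside⇒∉R y∉))) xy)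

  G⊆Sub : (∀ i j → Edge (induce G ι) i j → Edge H′ i j) → ∀ x y → Edge G x y → Edge Sub x y
  G⊆Sub Gι⊆H′ x y = by-sides (image? ι x) (image? ι y)
    where
    by-sides : Dec (Image ι x) → Dec (Image ι y) → Edge G x y → Edge Sub x y
    by-sides (yes (i , ιi≡x)) (yes (j , ιj≡y)) =
      subst₂ (λ x y → Edge G x y → Edge Sub x y) ιi≡x ιj≡y λ xy → trans (adj-ι-ι i j) (Gι⊆H′ i j xy)
    by-sides (yes x∈) (no y∉) xy = trans (adj-in-out x∈ y∉) (image-edge⇒r-edge x∈ y∉ xy)
    by-sides (no x∉) (yes y∈) xy =
      trans (adj-out-in x∉ y∈) (adj-flip G (image-edge⇒r-edge y∈ x∉ (adj-flip G xy)))
    by-sides (no x∉) (no y∉) xy = trans (adj-out-out x∉ y∉) xy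

  Sub-isSolution : IsSolution G s r Sub
  Sub-isSolution with (H′-sparse , s′r′ , Gι⊆H′) ← proj₁ H′-optimal =
    P4Sparse-Sub G-sparse H′-sparse r-off-outside-P4s ,
    subst₂ (Edge Sub) ιs′≡s ιr′≡r (trans (adj-ι-ι s′ r′) s′r′) ,
    G⊆Sub Gι⊆H′

  K′ : Pred (Fin n) 0ℓ
  K′ y = Bool.T (isK (part T y)) × y ≢ fs

  K′? : Decidable K′
  K′? y = Bool.T? (isK (part T y)) ×-dec ¬? (y ≟ fs)

  countK′ : ℕ
  countK′ = sum λ y → 1 when does (K′? y)

  image⇒¬K′ : ∀ {y} → Image ι y → does (K′? y) ≡ false
  image⇒¬K′ {y} y∈ with proj₂ (image-ι y) y∈
  ... | inj₁ refl rewrite s∈S = refl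
  ... | inj₂ y∈R rewrite y∈R = refl

  new-neighbours-of-s : ∀ {y} → ¬ Image ι y → adj G r y ∧ not (adj G s y) ≡ does (K′? y)
  new-neighbours-of-s {y} y∉ with part T y in y∈
  ... | inK rewrite R-K T r y r∈R y∈ | S-adj-K s∈S y∈ = refl
  ... | inS rewrite R-S T r y r∈R y∈ = refl
  ... | inR = ⊥-elim (outside⇒∉R y∉ y∈)

  sK′-edge : Fin n → Fin n → ℕ
  sK′-edge x y = 1 when does (K′? y) when does (s ≟ x)

  sK′-edge-inside : ∀ {x y} → Image ι y → sK′-edge x y ≡ 0
  sK′-edge-inside {x} y∈ rewrite image⇒¬K′ y∈ with does (s ≟ x)
  ... | true  = refl
  ... | false = refl

  sK′-edge-≢s : ∀ {x y} → x ≢ s → sK′-edge x y ≡ 0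
  sK′-edge-≢s {x} x≢s rewrite dec-false (s ≟ x) (≢-sym x≢s) = refl

  crossNewEdge-in-out : ∀ {x y} → Image ι x → ¬ Image ι y → crossNewEdge ι G Sub x y ≡ sK′-edge x y
  crossNewEdge-in-out {x} {y} x∈ y∉
    rewrite dec-true (image? ι x) x∈ | dec-false (image? ι y) y∉ | adj-in-out x∈ y∉
    with proj₂ (image-ι x) x∈
  ... | inj₁ refl rewrite dec-true (s ≟ s) refl = cong (1 when_) (new-neighbours-of-s y∉)
  ... | inj₂ x∈R rewrite R-adj x∈R (outside⇒∉R y∉) | r-adj-outside y∉
                       | ∧-inverseʳ (isK (part T y)) =
    sym (sK′-edge-≢s (part-≢ x∈R s∈S λ ()))

  crossNewEdge-Sub : ∀ x y → crossNewEdge ι G Sub x y ≡ sK′-edge x y + sK′-edge y x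
  crossNewEdge-Sub x y = by-sides (image? ι x) (image? ι y)
    where
    by-sides : Dec (Image ι x) → Dec (Image ι y) → crossNewEdge ι G Sub x y ≡ sK′-edge x y + sK′-edge y x
    by-sides (yes x∈) (yes y∈) rewrite dec-true (image? ι x) x∈ | dec-true (image? ι y) y∈
                                     | sK′-edge-inside {x} y∈ | sK′-edge-inside {y} x∈ = refl
    by-sides (yes x∈) (no y∉) rewrite sK′-edge-≢s {y} {x} (outside⇒≢s y∉) =
      trans (crossNewEdge-in-out x∈ y∉) (sym (+-identityʳ _))
    by-sides (no x∉) (yes y∈) rewrite sK′-edge-≢s {x} {y} (outside⇒≢s x∉) =
      trans (crossNewEdge-sym ι G Sub x y) (crossNewEdge-in-out y∈ x∉)
    by-sides (no x∉) (no y∉)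
      rewrite dec-false (image? ι x) x∉ | adj-out-out x∉ y∉ | ∧-inverseʳ (adj G x y)
            | sK′-edge-≢s {x} {y} (outside⇒≢s x∉) | sK′-edge-≢s {y} {x} (outside⇒≢s y∉) = refl

  crossFill-Sub : crossFill ι G Sub ≡ 2 * countK′
  crossFill-Sub = begin
    crossFill ι G Sub
      ≡⟨ sum-cong-≗ (λ x → trans (sum-cong-≗ (crossNewEdge-Sub x))
                                 (∑-distrib-+ (sK′-edge x) (λ y → sK′-edge y x))) ⟩
    sum (λ x → sum (sK′-edge x) + sum (λ y → sK′-edge y x))
      ≡⟨ ∑-distrib-+ (λ x → sum (sK′-edge x)) (λ x → sum (λ y → sK′-edge y x)) ⟩
    sum (λ x → sum (sK′-edge x)) + sum (λ x → sum (λ y → sK′-edge y x))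
      ≡⟨ cong (sum (λ x → sum (sK′-edge x)) +_) (sym (∑-comm sK′-edge)) ⟩
    sK′-edges + sK′-edges
      ≡⟨ cong₂ _+_ sK′-edges≡countK′ sK′-edges≡countK′ ⟩
    countK′ + countK′
      ≡⟨ cong (countK′ +_) (sym (+-identityʳ countK′)) ⟩
    2 * countK′ ∎
    where
    open ≡-Reasoning
    sK′-edges : ℕ
    sK′-edges = sum λ x → sum (sK′-edge x)
    sK′-edges≡countK′ : sK′-edges ≡ countK′
    sK′-edges≡countK′ = trans (sum-cong-≗ λ x → sum-when (does (s ≟ x)) (λ y → 1 when does (K′? y)))
                          (sum-single s (λ _ → countK′))

  -- S′ = S ∖ {s} and Y = K′ ∪ S′, described through the image {s} ∪ R of ι.
  Y : Pred (Fin n) 0ℓ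
  Y y = ¬ Image ι y × y ≢ fs

  Y? : Decidable Y
  Y? y = ¬? (image? ι y) ×-dec ¬? (y ≟ fs)

  S′ : Pred (Fin n) 0ℓ
  S′ y = ¬ Image ι y × ¬ Bool.T (isK (part T y))

  S′? : Decidable S′
  S′? y = ¬? (image? ι y) ×-dec ¬? (Bool.T? (isK (part T y)))

  partner-≢s : ∀ {k} → K′ k → partner k ≢ s
  partner-≢s (Kk , k≢fs) t≡s = k≢fs (trans (sym (proj₂ (partner-spec (isK⇒K Kk)))) (cong (f T) t≡s))

  partner-S′ : ∀ {k} → K′ k → S′ (partner k)
  partner-S′ {k} k∈K′@(Kk , _) =
    S∖s⇒outside t∈S (partner-≢s k∈K′) , subst (λ p → ¬ Bool.T (isK p)) (sym t∈S) λ ()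
    where
    t∈S : part T (partner k) ≡ inS
    t∈S = proj₁ (partner-spec (isK⇒K Kk))

  partner-inj : ∀ {k l} → K′ k → K′ l → partner k ≡ partner l → k ≡ l
  partner-inj (Kk , _) (Kl , _) same = trans (sym (proj₂ (partner-spec (isK⇒K Kk))))
    (trans (cong (f T) same) (proj₂ (partner-spec (isK⇒K Kl))))

  module LowerBound (X : Graph n) (X-sol : IsSolution G s r X) where

    deg : Fin n → ℕ
    deg = outDegree Y? G X

    deg-≥ : ∀ y {x} → ¬ Y x → newEdge G X y x ≤ deg y
    deg-≥ y {x} ¬Yx = subst (λ b → newEdge G X y x when not b ≤ deg y) (dec-false (Y? x) ¬Yx)
      (point≤sum (λ z → newEdge G X y z when not (does (Y? z))) x)

    no-new-edge : ∀ {y x} → deg y ≡ 0 → ¬ Y x → NonEdge G y x → NonEdge X y x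
    no-new-edge {y} deg≡0 ¬Yx yx =
      newEdge≡0⇒NonEdge {G = G} {H = X} yx (n≤0⇒n≡0 (subst (_ ≤_) deg≡0 (deg-≥ y ¬Yx)))

    five-distinct : ∀ {k} → K′ k → Unique (s ∷ r ∷ k ∷ partner k ∷ fs ∷ [])
    five-distinct {k} k∈K′@(Kk , k≢fs) =
      (part-≢ s∈S r∈R (λ ()) ∷ part-≢ s∈S k∈K (λ ()) ∷ ≢-sym (partner-≢s k∈K′)
         ∷ part-≢ s∈S fs∈K (λ ()) ∷ [])
      ∷ (part-≢ r∈R k∈K (λ ()) ∷ part-≢ r∈R t∈S (λ ()) ∷ part-≢ r∈R fs∈K (λ ()) ∷ [])
      ∷ (part-≢ k∈K t∈S (λ ()) ∷ k≢fs ∷ [])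
      ∷ (part-≢ t∈S fs∈K (λ ()) ∷ [])
      ∷ [] ∷ []
      where
      k∈K : part T k ≡ inK
      k∈K = isK⇒K Kk
      t∈S : part T (partner k) ≡ inS
      t∈S = proj₁ (partner-spec k∈K)

    two-P4s : ∀ {k} → K′ k → deg k ≡ 0 → deg (partner k) ≡ 0 →
      IsP4 X s r k (partner k) × IsP4 X s fs k (partner k)
    two-P4s {k} (Kk , k≢fs) degk≡0 degt≡0 =
      (proj₁ (proj₂ X-sol) , G⊆X (R-K T r k r∈R k∈K) , kt , sk , rt , st) ,
      (G⊆X (proj₂ (S-K T s fs s∈S fs∈K) refl) , G⊆X (K-clique T fs k fs∈K k∈K (≢-sym k≢fs)) , kt ,
       sk , adj-flip X (no-new-edge degt≡0 (λ (_ , fs≢fs) → fs≢fs refl) tfs) , st)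
      where
      k∈K : part T k ≡ inK
      k∈K = isK⇒K Kk
      t : Fin n
      t = partner k
      t∈S : part T t ≡ inS
      t∈S = proj₁ (partner-spec k∈K)
      ft≡k : f T t ≡ k
      ft≡k = proj₂ (partner-spec k∈K)
      G⊆X : ∀ {x y} → Edge G x y → Edge X x y
      G⊆X = proj₂ (proj₂ X-sol) _ _
      ¬Y-inside : ∀ {x} → Image ι x → ¬ Y x
      ¬Y-inside x∈ (x∉ , _) = x∉ x∈
      kt : Edge X k t
      kt = G⊆X (adj-flip G (proj₂ (S-K T t k t∈S k∈K) (sym ft≡k)))
      sk : NonEdge X s k
      sk = adj-flip X (no-new-edge degk≡0 (¬Y-inside s∈ι)
             (adj-flip G (trans (S-adj-K s∈S k∈K) (dec-false (k ≟ fs) k≢fs))))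
      rt : NonEdge X r t
      rt = adj-flip X (no-new-edge degt≡0 (¬Y-inside r∈ι) (adj-flip G (R-S T r t r∈R t∈S)))
      st : NonEdge X s t
      st = adj-flip X (no-new-edge degt≡0 (¬Y-inside s∈ι) (S-indep T t s t∈S s∈S))
      tfs : NonEdge G t fs
      tfs = trans (S-adj-K t∈S fs∈K) (dec-false (fs ≟ f T t) λ fs≡ft → k≢fs (trans (sym ft≡k) (sym fs≡ft)))

    -- Otherwise s r k t and s (f s) k t would be two induced P4s of X on five vertices.
    new-edge-at-k-or-partner : ∀ {k} → K′ k → 1 ≤ deg k + deg (partner k)
    new-edge-at-k-or-partner {k} k∈K′ = n≢0⇒n>0 λ degs≡0 →
      let (P , Q) = two-P4s k∈K′ (m+n≡0⇒m≡0 (deg k) degs≡0) (m+n≡0⇒n≡0 (deg k) degs≡0)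
      in fs∉ (proj₁ (proj₂ (proj₁ X-sol (lookup (s ∷ r ∷ k ∷ partner k ∷ fs ∷ []))
                                        (λ {i} {j} → lookup-injective (five-distinct k∈K′) i j)
                                        0F 1F 2F 3F 0F 4F 2F 3F P Q)))
      where
      fs∉ : ¬ Among {5} 4F 0F 1F 2F 3F
      fs∉ (inj₂ (inj₂ (inj₂ ())))

    K′⊎S′⊆Y : ∀ y → deg y when does (K′? y) + deg y when does (S′? y) ≤ deg y when does (Y? y)
    K′⊎S′⊆Y y = cases (K′? y) (S′? y) (Y? y)
      where
      cases : (K′y? : Dec (K′ y)) (S′y? : Dec (S′ y)) (Yy? : Dec (Y y)) →
        deg y when does K′y? + deg y when does S′y? ≤ deg y when does Yy?
      cases (yes (y∈K , _))    (yes (_ , y∉K)) _        = ⊥-elim (y∉K y∈K)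
      cases (yes _)            (no _)          (yes _)  = ≤-reflexive (+-identityʳ _)
      cases (yes (y∈K , y≢fs)) (no _)          (no ¬Yy) = ⊥-elim (¬Yy (K⇒outside (isK⇒K y∈K) , y≢fs))
      cases (no _)             (yes _)         (yes _)  = ≤-refl
      cases (no _)             (yes (y∉ , y∉K)) (no ¬Yy) =
        ⊥-elim (¬Yy (y∉ , λ { refl → y∉K (subst (Bool.T ∘ isK) (sym fs∈K) _) }))
      cases (no _)             (no _)          _        = z≤n

    countK′≤boundaryFill : countK′ ≤ boundaryFill Y? G X
    countK′≤boundaryFill = begin
      sum (λ k → 1 when does (K′? k))
        ≤⟨ sum-mono-≤ one≤ ⟩
      sum (λ k → deg k when does (K′? k) + deg (partner k) when does (K′? k))
        ≡⟨ ∑-distrib-+ (λ k → deg k when does (K′? k)) (λ k → deg (partner k) when does (K′? k)) ⟩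
      sum (λ k → deg k when does (K′? k)) + sum (λ k → deg (partner k) when does (K′? k))
        ≤⟨ +-monoʳ-≤ (sum (λ k → deg k when does (K′? k)))
                     (sum-reindex-≤ partner K′? S′? partner-S′ partner-inj deg) ⟩
      sum (λ y → deg y when does (K′? y)) + sum (λ y → deg y when does (S′? y))
        ≡⟨ sym (∑-distrib-+ (λ y → deg y when does (K′? y)) (λ y → deg y when does (S′? y))) ⟩
      sum (λ y → deg y when does (K′? y) + deg y when does (S′? y))
        ≤⟨ sum-mono-≤ K′⊎S′⊆Y ⟩
      boundaryFill Y? G X ∎
      where
      open ≤-Reasoning
      one≤ : ∀ k → 1 when does (K′? k) ≤ deg k when does (K′? k) + deg (partner k) when does (K′? k)
      one≤ k = cases (K′? k)
        where
        cases : (K′k? : Dec (K′ k)) → 1 when does K′k? ≤ deg k when does K′k? + deg (partner k) when does K′k?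
        cases (yes k∈K′) = new-edge-at-k-or-partner k∈K′
        cases (no _)     = z≤n

    2*countK′≤crossFill : 2 * countK′ ≤ crossFill ι G X
    2*countK′≤crossFill =
      ≤-trans (*-monoʳ-≤ 2 countK′≤boundaryFill) (boundaryFill-≤-crossFill ι Y? proj₁ G X)

  cardK∸1≡countK′ : cardK T ∸ 1 ≡ countK′
  cardK∸1≡countK′ = begin
    cardK T ∸ 1
      ≡⟨ cong (_∸ 1) (sumFin≡sum (λ y → 1 when isK (part T y))) ⟩
    sum (λ y → 1 when isK (part T y)) ∸ 1
      ≡⟨ cong (_∸ 1) (trans (sum-cong-≗ split) (∑-distrib-+ (λ y → 1 when does (K′? y)) _)) ⟩
    countK′ + sum (λ y → 1 when does (fs ≟ y)) ∸ 1
      ≡⟨ cong (λ c → countK′ + c ∸ 1) (sum-single fs (λ _ → 1)) ⟩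
    countK′ + 1 ∸ 1
      ≡⟨ m+n∸n≡m countK′ 1 ⟩
    countK′ ∎
    where
    open ≡-Reasoning
    split : ∀ y → 1 when isK (part T y) ≡ 1 when does (K′? y) + 1 when does (fs ≟ y)
    split y with y ≟ fs
    ... | yes refl rewrite dec-true (fs ≟ fs) refl | fs∈K = refl
    ... | no y≢fs rewrite dec-false (fs ≟ y) (≢-sym y≢fs) | ∧-identityʳ (isK (part T y)) =
      sym (+-identityʳ _)

  2*fill-Sub : 2 * fill G Sub ≡ 2 * fill (induce G ι) H′ + 2 * countK′
  2*fill-Sub = begin
    2 * fill G Sub
      ≡⟨ 2*fill-split ι ι-inj G Sub ⟩
    2 * fill (induce G ι) (induce Sub ι) + crossFill ι G Sub
      ≡⟨ cong₂ (λ a b → 2 * a + b) (fill-cong (induce G ι) {induce Sub ι} {H′} adj-ι-ι) crossFill-Sub ⟩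
    2 * fill (induce G ι) H′ + 2 * countK′ ∎
    where open ≡-Reasoning

  fill-Sub : fill G Sub ≡ countK′ + fill (induce G ι) H′
  fill-Sub = *-cancelˡ-≡ _ _ 2 (begin
    2 * fill G Sub                                  ≡⟨ 2*fill-Sub ⟩
    2 * fill (induce G ι) H′ + 2 * countK′          ≡⟨ +-comm (2 * fill (induce G ι) H′) _ ⟩
    2 * countK′ + 2 * fill (induce G ι) H′          ≡⟨ sym (*-distribˡ-+ 2 countK′ _) ⟩
    2 * (countK′ + fill (induce G ι) H′)            ∎)
    where open ≡-Reasoning

  Sub-minimal : ∀ X → IsSolution G s r X → fill G Sub ≤ fill G X
  Sub-minimal X X-sol = *-cancelˡ-≤ 2 (begin
    2 * fill G Sub
      ≡⟨ 2*fill-Sub ⟩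
    2 * fill (induce G ι) H′ + 2 * countK′
      ≤⟨ +-mono-≤ (*-monoʳ-≤ 2 (proj₂ H′-optimal (induce X ι)
                                 (IsSolution-induce {G = G} {X = X} ι ι-inj ιs′≡s ιr′≡r X-sol)))
                  (LowerBound.2*countK′≤crossFill X X-sol) ⟩
    2 * fill (induce G ι) (induce X ι) + crossFill ι G X
      ≡⟨ sym (2*fill-split ι ι-inj G X) ⟩
    2 * fill G X ∎)
    where open ≤-Reasoning

lemma13 : ∀ {n} (G : Graph n) → P4Sparse G → (T : ThinSpider G) →
    (s r : Fin n) → part T s ≡ inS → part T r ≡ inR → NonEdge G s r →
    (m : ℕ) (ι : Fin m → Fin n) → Injective _≡_ _≡_ ι →
    (∀ x → (x ≡ s ⊎ part T x ≡ inR → Σ (Fin m) λ i → ι i ≡ x)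
         × (Σ (Fin m) (λ i → ι i ≡ x) → x ≡ s ⊎ part T x ≡ inR)) →
    (s′ r′ : Fin m) → ι s′ ≡ s → ι r′ ≡ r →
    (H′ : Graph m) → IsOptimal (induce G ι) s′ r′ H′ →
    Σ (Graph n) λ H → IsOptimal G s r H ×
      fill G H ≡ (cardK T ∸ 1) + fill (induce G ι) H′
lemma13 G G-sparse T s r s∈S r∈R _ m ι ι-inj image-ι s′ r′ ιs′≡s ιr′≡r H′ H′-optimal =
  Sub , (Sub-isSolution , Sub-minimal) ,
  trans fill-Sub (cong (_+ fill (induce G ι) H′) (sym cardK∸1≡countK′))
  where
  open ThinSpiderExpansion G G-sparse T s r s∈S r∈R ι ι-inj image-ι s′ r′ ιs′≡s ιr′≡r H′ H′-optimal
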